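{- Let $G=(V,E)$ be a connected, locally connected graph with at least one edge, and let $uv \in E$ be an arbitrary edge. Then the vertices of $G$ can be ordered as $(u, v, v_1, \ldots, v_k)$ such that for each $i \in \{1,\ldots,k\}$, the vertex $v_i$ has at least two neighbours in $\{u,v,v_1,\ldots,v_{i-1}\}$ that are adjacent to each other.
   Context: All graphs are finite, undirected, without loops or multiple edges. $N(v)$ denotes the open neighbourhood of $v$. A graph is locally connected if for every vertex $v$ the induced subgraph $G[N(v)]$ is connected. -}

module Defs where

open import Data.Nat using (ℕ; zero; suc; _<_; _≤_)
open import Data.Fin using (Fin; toℕ; _<_)
open import Data.Product using (Σ; ∃; ∃-syntax; _×_; _,_)
open import Data.Unit using (⊤)
open import Relation.Nullary using (¬_)
open import Relation.Binary.PropositionalEquality using (_≡_)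
open import Function.Bundles using (_↔_; Inverse)

record Graph (n : ℕ) : Set₁ where
  field
    Adj   : Fin n → Fin n → Set
    sym   : ∀ {x y} → Adj x y → Adj y x
    irrefl : ∀ {x} → ¬ Adj x x

data WalkIn {n : ℕ} (G : Graph n) (P : Fin n → Set) : Fin n → Fin n → Set where
  here : ∀ {x} → P x → WalkIn G P x x
  step : ∀ {x y z} → P x → Graph.Adj G x y → WalkIn G P y z → WalkIn G P x z

Any : {n : ℕ} → Fin n → Set
Any _ = ⊤

Connected : {n : ℕ} → Graph n → Set
Connected {n} G = ∀ (x y : Fin n) → WalkIn G Any x y

N : {n : ℕ} → Graph n → Fin n → Fin n → Set
N G v x = Graph.Adj G v x

-- G[N(v)] is connected: any two vertices of N(v) are joined by a walk inside N(v).
-- (The empty graph counts as connected, as usual for this definition.)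
LocallyConnected : {n : ℕ} → Graph n → Set
LocallyConnected {n} G =
  ∀ (v x y : Fin n) → N G v x → N G v y → WalkIn G (N G v) x y

HasEdge : {n : ℕ} → Graph n → Set
HasEdge {n} G = Σ (Fin n) λ x → Σ (Fin n) λ y → Graph.Adj G x y

-- An ordering of the vertices: a bijection σ from positions Fin n to vertices,
-- position i holding vertex σ i.  The ordering (u, v, v₁, …, v_k) has u at
-- position 0, v at position 1, and v_i at position i+1.
-- Good ordering: every vertex at a position i ≥ 2 has two neighbours at
-- earlier positions j, l < i which are adjacent to each other.
GoodOrdering : {n : ℕ} → Graph n → Fin n → Fin n → (Fin n ↔ Fin n) → Set
GoodOrdering {n} G u v σ =
  (toℕ (Inverse.from σ u) ≡ 0) × (toℕ (Inverse.from σ v) ≡ 1) ×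
  (∀ (i : Fin n) → 2 ≤ toℕ i →
     Σ (Fin n) λ j → Σ (Fin n) λ l →
       (j Data.Fin.< i) × (l Data.Fin.< i) ×
       Graph.Adj G (f i) (f j) × Graph.Adj G (f i) (f l) × Graph.Adj G (f j) (f l))
  where
    f : Fin n → Fin n
    f = Inverse.to σ

-- Grow the ordering one vertex at a time.  Let S be the set of vertices placed
-- so far; every vertex of S has a neighbour in S.  While S ≠ V, connectivity gives
-- an edge cd leaving S (c ∈ S, d ∉ S).  Local connectivity at c joins a neighbour
-- of c inside S to d by a walk in N(c); that walk leaves S along an edge c′d′, and
-- then c, c′ are two adjacent neighbours of d′ in S, so d′ can be placed next.
-- The invariant persists because u ~ v and each later vertex joins S next to two
-- vertices of S.
module Submission where

open import Defs
open import Data.Nat as ℕ using (ℕ; zero; suc; z≤n; s≤s)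
import Data.Nat.Properties as ℕ
open import Data.Fin as Fin using (Fin; zero; suc; toℕ; inject₁; fromℕ; punchOut)
open import Data.Fin.Properties
  using (any?; ¬∀⟶∃¬; injective⇒≤; punchOut-injective; toℕ-inject₁; ≤̄⇒inject₁<; ≤fromℕ)
open import Data.Fin.Relation.Unary.Top using (view; ‵fromℕ; ‵inject₁)
open import Data.Vec.Functional using (Vector; []; _∷_; init; last)
open import Data.Product using (Σ; ∃; _×_; _,_; proj₁; proj₂)
open import Data.Empty using (⊥-elim)
open import Function.Base using (_∘_)
open import Function.Bundles using (_↔_; Inverse; mk↔ₛ′)
open import Function.Definitions using (Injective)
open import Relation.Nullary using (¬_; yes; no; contradiction)
open import Relation.Unary using (Pred; Decidable)
open import Relation.Binary.PropositionalEquality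

private
  variable
    k m : ℕ
    A : Set

Image : (Fin m → A) → Pred A _
Image f x = ∃ λ i → f i ≡ x

image? : (f : Fin m → Fin k) → Decidable (Image f)
image? f x = any? (λ i → f i Fin.≟ x)

surjective⇒≤ : (f : Fin m → Fin k) → (∀ x → Image f x) → k ℕ.≤ m
surjective⇒≤ f surj = injective⇒≤ section-injective
  where
    section-injective : Injective _≡_ _≡_ (proj₁ ∘ surj)
    section-injective {x} {y} eq =
      trans (sym (proj₂ (surj x))) (trans (cong f eq) (proj₂ (surj y)))

<⇒∃∉Image : m ℕ.< k → (f : Fin m → Fin k) → ∃ λ x → ¬ Image f x
<⇒∃∉Image m<k f =
  ¬∀⟶∃¬ _ (Image f) (image? f) (λ surj → ℕ.<⇒≱ m<k (surjective⇒≤ f surj))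

injective⇒surjective : {f : Fin m → Fin m} → Injective _≡_ _≡_ f → ∀ x → Image f x
injective⇒surjective {suc m} {f} f-inj x with image? f x
... | yes x∈f = x∈f
... | no  x∉f = contradiction (injective⇒≤ punched-injective) ℕ.1+n≰n
  where
    x≢f : ∀ i → x ≢ f i
    x≢f i eq = x∉f (i , sym eq)
    punched-injective : Injective _≡_ _≡_ (λ i → punchOut (x≢f i))
    punched-injective {i} {j} = f-inj ∘ punchOut-injective (x≢f i) (x≢f j)

inject₁-mono-< : {i j : Fin m} → i Fin.< j → inject₁ i Fin.< inject₁ j
inject₁-mono-< {i = i} {j} = subst₂ ℕ._<_ (sym (toℕ-inject₁ i)) (sym (toℕ-inject₁ j))

injective⇒↔ : {f : Fin m → Fin m} → Injective _≡_ _≡_ f → Fin m ↔ Fin m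
injective⇒↔ {f = f} f-inj =
  mk↔ₛ′ f (proj₁ ∘ surj) (proj₂ ∘ surj) (λ i → f-inj (proj₂ (surj (f i))))
  where surj = injective⇒surjective f-inj

_∷ʳ_ : Vector A m → A → Vector A (suc m)
_∷ʳ_ {m = zero}  xs x _       = x
_∷ʳ_ {m = suc m} xs x zero    = xs zero
_∷ʳ_ {m = suc m} xs x (suc i) = ((xs ∘ suc) ∷ʳ x) i

init-∷ʳ : (xs : Vector A m) (x : A) (i : Fin m) → init (xs ∷ʳ x) i ≡ xs i
init-∷ʳ {m = suc m} xs x zero    = refl
init-∷ʳ {m = suc m} xs x (suc i) = init-∷ʳ (xs ∘ suc) x i

last-∷ʳ : (xs : Vector A m) (x : A) → last (xs ∷ʳ x) ≡ x
last-∷ʳ {m = zero}  xs x = refl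
last-∷ʳ {m = suc m} xs x = last-∷ʳ (xs ∘ suc) x

∷ʳ-injective : {xs : Vector A m} {x : A} →
               Injective _≡_ _≡_ xs → ¬ Image xs x → Injective _≡_ _≡_ (xs ∷ʳ x)
∷ʳ-injective {xs = xs} {x} xs-inj x∉xs {i} {j} eq with view i | view j
... | ‵fromℕ     | ‵fromℕ     = refl
... | ‵inject₁ a | ‵inject₁ b =
  cong inject₁ (xs-inj (trans (sym (init-∷ʳ xs x a)) (trans eq (init-∷ʳ xs x b))))
... | ‵inject₁ a | ‵fromℕ     =
  ⊥-elim (x∉xs (a , trans (sym (init-∷ʳ xs x a)) (trans eq (last-∷ʳ xs x))))
... | ‵fromℕ     | ‵inject₁ b =
  ⊥-elim (x∉xs (b , trans (sym (init-∷ʳ xs x b)) (trans (sym eq) (last-∷ʳ xs x))))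

module _ {n : ℕ} (G : Graph n) where
  open Graph G renaming (sym to adj-sym)

  record Crossing (P Q : Fin n → Set) : Set where
    field
      {inner outer} : Fin n
      inner∈P : P inner
      outer∈P : P outer
      inner∈Q : Q inner
      outer∉Q : ¬ Q outer
      edge    : Adj inner outer

  walk-head : ∀ {P a b} → WalkIn G P a b → P a
  walk-head (here a∈P)     = a∈P
  walk-head (step a∈P _ _) = a∈P

  walk⇒crossing : ∀ {P Q a b} → Decidable Q → WalkIn G P a b → Q a → ¬ Q b → Crossing P Q
  walk⇒crossing Q? (here _) a∈Q b∉Q = contradiction a∈Q b∉Q
  walk⇒crossing Q? (step {y = y} a∈P a~y w) a∈Q b∉Q with Q? y
  ... | yes y∈Q = walk⇒crossing Q? w y∈Q b∉Q
  ... | no  y∉Q = record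
    { inner∈P = a∈P ; outer∈P = walk-head w ; inner∈Q = a∈Q ; outer∉Q = y∉Q ; edge = a~y }

  record Attachment (S : Fin n → Set) : Set where
    field
      {new base₁ base₂} : Fin n
      new∉S      : ¬ S new
      base₁∈S    : S base₁
      base₂∈S    : S base₂
      new~base₁  : Adj new base₁
      new~base₂  : Adj new base₂
      base₁~base₂ : Adj base₁ base₂

  attachment : Connected G → LocallyConnected G →
               ∀ {S a b} → Decidable S → (∀ {x} → S x → ∃ λ y → S y × Adj x y) →
               S a → ¬ S b → Attachment S
  attachment conn loc S? no-isolated a∈S b∉S
    with record { inner∈Q = c∈S ; outer∉Q = d∉S ; edge = c~d } ← walk⇒crossing S? (conn _ _) a∈S b∉S
    with w , w∈S , c~w ← no-isolated c∈S
    with record { inner∈P = c~c′ ; outer∈P = c~d′ ; inner∈Q = c′∈S ; outer∉Q = d′∉S ; edge = c′~d′ }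
           ← walk⇒crossing S? (loc _ _ _ c~w c~d) w∈S d∉S
    = record { new∉S = d′∉S ; base₁∈S = c∈S ; base₂∈S = c′∈S
             ; new~base₁ = adj-sym c~d′ ; new~base₂ = adj-sym c′~d′ ; base₁~base₂ = c~c′ }

  EarlierTriangle : Vector (Fin n) m → Fin m → Set
  EarlierTriangle {m} f i = Σ (Fin m) λ j → Σ (Fin m) λ l →
    (j Fin.< i) × (l Fin.< i) × Adj (f i) (f j) × Adj (f i) (f l) × Adj (f j) (f l)

  inject₁-triangle : {xs : Vector (Fin n) m} {x : Fin n} {i : Fin m} →
                     EarlierTriangle xs i → EarlierTriangle (xs ∷ʳ x) (inject₁ i)
  inject₁-triangle {xs = xs} {x} {i} (j , l , j<i , l<i , i~j , i~l , j~l) =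
    inject₁ j , inject₁ l , inject₁-mono-< j<i , inject₁-mono-< l<i ,
    lift i~j , lift i~l , lift j~l
    where
      lift : ∀ {a b} → Adj (xs a) (xs b) → Adj ((xs ∷ʳ x) (inject₁ a)) ((xs ∷ʳ x) (inject₁ b))
      lift {a} {b} = subst₂ Adj (sym (init-∷ʳ xs x a)) (sym (init-∷ʳ xs x b))

  last-triangle : {xs : Vector (Fin n) (suc m)} {x : Fin n} (j l : Fin (suc m)) →
                  Adj x (xs j) → Adj x (xs l) → Adj (xs j) (xs l) →
                  EarlierTriangle (xs ∷ʳ x) (fromℕ (suc m))
  last-triangle {xs = xs} {x} j l x~j x~l j~l =
    inject₁ j , inject₁ l , ≤̄⇒inject₁< (≤fromℕ j) , ≤̄⇒inject₁< (≤fromℕ l) ,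
    subst₂ Adj (sym (last-∷ʳ xs x)) (sym (init-∷ʳ xs x j)) x~j ,
    subst₂ Adj (sym (last-∷ʳ xs x)) (sym (init-∷ʳ xs x l)) x~l ,
    subst₂ Adj (sym (init-∷ʳ xs x j)) (sym (init-∷ʳ xs x l)) j~l

  module _ {u v : Fin n} (u~v : Adj u v) where

    record GoodPrefix (k : ℕ) : Set where
      field
        order           : Vector (Fin n) (2 ℕ.+ k)
        order-injective : Injective _≡_ _≡_ order
        order-0         : order zero ≡ u
        order-1         : order (suc zero) ≡ v
        triangle        : ∀ i → 2 ℕ.≤ toℕ i → EarlierTriangle order i

    open GoodPrefix

    initial : GoodPrefix 0
    initial = record
      { order = u ∷ v ∷ [] ; order-injective = injective ; order-0 = refl ; order-1 = refl
      ; triangle = λ { zero () ; (suc zero) (s≤s ()) } }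
      where
        injective : Injective _≡_ _≡_ (u ∷ v ∷ [])
        injective {zero}     {zero}     _   = refl
        injective {zero}     {suc zero} u≡v = contradiction (subst (Adj u) (sym u≡v) u~v) irrefl
        injective {suc zero} {zero}     v≡u = contradiction (subst (Adj u) v≡u u~v) irrefl
        injective {suc zero} {suc zero} _   = refl

    no-isolated : (p : GoodPrefix k) → ∀ {x} → Image (order p) x →
                  ∃ λ y → Image (order p) y × Adj x y
    no-isolated p (zero , refl) =
      _ , (suc zero , refl) , subst₂ Adj (sym (order-0 p)) (sym (order-1 p)) u~v
    no-isolated p (suc zero , refl) =
      _ , (zero , refl) , subst₂ Adj (sym (order-1 p)) (sym (order-0 p)) (adj-sym u~v)
    no-isolated p (i@(suc (suc _)) , refl)
      with j , _ , _ , _ , i~j , _ ← triangle p i (s≤s (s≤s z≤n)) = _ , (j , refl) , i~j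

    extend : (p : GoodPrefix k) → Attachment (Image (order p)) → GoodPrefix (suc k)
    extend p record { new∉S = x∉p ; base₁∈S = j , refl ; base₂∈S = l , refl
                    ; new~base₁ = x~j ; new~base₂ = x~l ; base₁~base₂ = j~l } = record
      { order = order p ∷ʳ _ ; order-injective = ∷ʳ-injective (order-injective p) x∉p
      ; order-0 = order-0 p ; order-1 = order-1 p ; triangle = triangle′ }
      where
        triangle′ : ∀ i → 2 ℕ.≤ toℕ i → EarlierTriangle (order p ∷ʳ _) i
        triangle′ i 2≤i with view i
        ... | ‵fromℕ     = last-triangle j l x~j x~l j~l
        ... | ‵inject₁ a = inject₁-triangle (triangle p a (subst (2 ℕ.≤_) (toℕ-inject₁ a) 2≤i))

    prefix : Connected G → LocallyConnected G → ∀ k → 2 ℕ.+ k ℕ.≤ n → GoodPrefix k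
    prefix conn loc zero    _     = initial
    prefix conn loc (suc k) 3+k≤n =
      extend p (attachment conn loc (image? (order p)) (no-isolated p) (zero , refl) outside)
      where
        p = prefix conn loc k (ℕ.<⇒≤ 3+k≤n)
        outside = proj₂ (<⇒∃∉Image 3+k≤n (order p))

theorem3 : ∀ {n : ℕ} (G : Graph n) → Connected G → LocallyConnected G → HasEdge G →
    ∀ (u v : Fin n) → Graph.Adj G u v →
    Σ (Fin n ↔ Fin n) λ σ → GoodOrdering G u v σ
theorem3 {zero}        _ _    _   _ ()   _    _
theorem3 {suc zero}    G _    _   _ zero zero u~u = contradiction u~u (Graph.irrefl G)
theorem3 {suc (suc m)} G conn loc _ u    v    u~v =
  σ , position order-0 , position order-1 , triangle
  where
    open GoodPrefix (prefix G u~v conn loc m ℕ.≤-refl)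
    σ : Fin (suc (suc m)) ↔ Fin (suc (suc m))
    σ = injective⇒↔ order-injective
    position : ∀ {i x} → order i ≡ x → toℕ (Inverse.from σ x) ≡ toℕ i
    position {i} refl = cong toℕ (Inverse.strictlyInverseʳ σ i)
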